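{- Let $C>0$ be a fixed constant and $s=s(n)=C\log_2 n$. For every function $t=t(n)$ with $t(n)\to\infty$ and $t(n)\le s(n)$, for all sufficiently large $n$, $$|\mathcal X_0(n,t)|<2^{(0.6\log_2 3+o(1))tn}F(n-t),$$ where $o(1)$ denotes a quantity tending to $0$ as $n\to\infty$.
   Context: A colored graph is a simple graph with each edge colored red or blue; it is odd-blue-triangle-free (OBTF) if it contains no triangle with an odd number of blue edges. $\mathcal F(m)$ is the set of labelled OBTF colored graphs on vertex set $[m]$, $F(m)=|\mathcal F(m)|$. For a graph $G$ and $Q\subseteq V(G)$, $\Gamma(Q)=\bigl(\bigcup_{x\in Q}\Gamma_x\bigr)\setminus Q$, where $\Gamma_x$ is the neighborhood of $x$. $\mathcal X_0(n,t)=\{G\in\mathcal F(n):\exists\,Q\subseteq V(G)\text{ with }|Q|=t\text{ and }|\Gamma(Q)|<0.6n\}$. Large quantities such as $s$ are treated as integers. -}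

module Defs where

open import Data.Nat using (ℕ; zero; suc; _+_; _*_; _<_)
open import Data.Nat.Properties using (_<?_)
open import Data.Bool using (Bool; true; false)
open import Data.Fin using (Fin; zero; suc)
open import Data.Fin.Properties using (all?; any?)
open import Data.Fin.Subset using (Subset; _∈_; _∉_; ∣_∣)
open import Data.Fin.Subset.Properties using (_∈?_; anySubset?)
open import Data.Vec using (Vec; []; _∷_; tabulate)
import Data.Vec as Vec
open import Data.List using (List; []; _∷_; concatMap; map; filter; length)
open import Data.Product using (_×_; _,_; ∃; ∃-syntax)
open import Data.Unit using (⊤; tt)
open import Relation.Nullary using (¬_; Dec; yes; no; ¬?)
open import Relation.Nullary.Decidable using (_×-dec_; _→-dec_; ⌊_⌋)
open import Relation.Binary.PropositionalEquality using (_≡_; _≢_)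
open import Data.Nat.Properties using (_≟_)
import Data.Fin.Properties as FinP

-- Edge colour of an unordered pair of vertices: no edge, red edge, blue edge.
data Col : Set where
  none red blue : Col

-- Graph (suc m): vertex 'zero' is new; a vector records the colours of the
-- pairs {zero, suc j} for j : Fin m; the rest is a colored graph on the
-- old vertices (shifted by suc).  This is a bijective encoding of colored
-- simple graphs on [m].
Graph : ℕ → Set
Graph zero    = ⊤
Graph (suc m) = Graph m × Vec Col m

-- colour of the pair {x , y} (none on the diagonal: graphs are simple)
col : ∀ {m} → Graph m → Fin m → Fin m → Col
col {suc m} (g , v) zero    zero    = none
col {suc m} (g , v) zero    (suc j) = Vec.lookup v j
col {suc m} (g , v) (suc i) zero    = Vec.lookup v i
col {suc m} (g , v) (suc i) (suc j) = col g i j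

blueN : Col → ℕ
blueN none = 0
blueN red  = 0
blueN blue = 1

Edge : Col → Set
Edge c = c ≢ none

edge? : (c : Col) → Dec (Edge c)
edge? none = no λ z → z _≡_.refl
edge? red  = yes λ ()
edge? blue = yes λ ()

Adj : ∀ {m} → Graph m → Fin m → Fin m → Set
Adj g x y = Edge (col g x y)

Odd : ℕ → Set
Odd k = k Data.Nat.% 2 ≡ 1

OddBlueTriangle : ∀ {m} → Graph m → Fin m → Fin m → Fin m → Set
OddBlueTriangle g x y z =
  x Data.Fin.< y × y Data.Fin.< z ×
  Adj g x y × Adj g y z × Adj g x z ×
  Odd (blueN (col g x y) + blueN (col g y z) + blueN (col g x z))

OBTF : ∀ {m} → Graph m → Set
OBTF g = ∀ x y z → ¬ OddBlueTriangle g x y z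

OBTF? : ∀ {m} (g : Graph m) → Dec (OBTF g)
OBTF? g = all? λ x → all? λ y → all? λ z → ¬?
  (FinP._<?_ x y ×-dec FinP._<?_ y z ×-dec edge? _ ×-dec edge? _ ×-dec edge? _
    ×-dec ((blueN (col g x y) + blueN (col g y z) + blueN (col g x z)) Data.Nat.% 2 ≟ 1))

-- explicit enumeration (without repetition) of all colored graphs on [m]
allVecs : (k : ℕ) → List (Vec Col k)
allVecs zero    = [] ∷ []
allVecs (suc k) = concatMap (λ v → (none ∷ v) ∷ (red ∷ v) ∷ (blue ∷ v) ∷ []) (allVecs k)

allGraphs : (m : ℕ) → List (Graph m)
allGraphs zero    = tt ∷ []
allGraphs (suc m) = concatMap (λ g → map (g ,_) (allVecs m)) (allGraphs m)

F : ℕ → ℕ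
F m = length (filter OBTF? (allGraphs m))

Γ : ∀ {m} → Graph m → Subset m → Subset m
Γ g Q = tabulate λ y →
  ⌊ ¬? (y ∈? Q) ×-dec any? (λ x → (x ∈? Q) ×-dec edge? (col g x y)) ⌋

-- condition defining 𝓧₀(n,t): ∃ Q, |Q| = t and |Γ(Q)| < 0.6 n  (i.e. 5|Γ(Q)| < 3n)
X0cond : ∀ {n} → ℕ → Graph n → Set
X0cond {n} t g = ∃[ Q ] (∣ Q ∣ ≡ t × 5 * ∣ Γ g Q ∣ < 3 * n)

X0cond? : ∀ {n} t (g : Graph n) → Dec (X0cond t g)
X0cond? t g = anySubset? λ Q → (∣ Q ∣ ≟ t) ×-dec (_ <? _)

X0count : ℕ → ℕ → ℕ
X0count n t = length (filter (λ g → OBTF? g ×-dec X0cond? t g) (allGraphs n))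

-- A graph in 𝓧₀(n,t) has a set Q of size t with |Γ(Q)| < 0.6n, so S = Q ∪ Γ(Q) has
-- |S| ≤ t + 0.6n and every edge at a vertex of Q stays inside S.  Deleting the vertices
-- of Q one at a time, each deleted vertex is recorded by its name (n choices) and its
-- colors towards S (3^|S| choices), and what remains is an OBTF graph on n − t
-- vertices.  Summing over the at most 2^n sets S gives
-- |𝓧₀(n,t)| ≤ 2^n n^t 3^(t(t + 0.6n)) F(n − t).  Since t → ∞ while t = O(log n), the
-- factors 2^n, n^t and 3^(t²) are 2^(o(tn)); in the formal statement the o(1) is 1/q
-- and both sides are raised to the power 5q.

module Submission where

open import Defs
open import Data.Nat
  using (ℕ; zero; suc; _+_; _*_; _^_; _∸_; _≤_; _<_; _≤′_; ≤′-refl; ≤′-step; z≤n; s≤s; NonZero; >-nonZero; _⊔_; _/_; _%_)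
open import Data.Nat.Properties
open import Data.Nat.DivMod using (m≡m%n+[m/n]*n; m%n<n; m*n/n≡m; /-monoˡ-≤; m/n*n≤m)
open import Data.Nat.Solver using (module +-*-Solver)
open import Data.Product using (_×_; _,_; ∃; ∃-syntax; proj₁; proj₂)
open import Data.Bool using (true; false)
open import Data.Fin as Fin using (Fin; zero; suc; punchIn; punchOut)
import Data.Fin.Properties as Finₚ
open import Data.Fin.Subset using (Subset; _∈_; _∉_; _⊆_; ∣_∣; _∪_; Nonempty; inside; outside)
open import Data.Fin.Subset.Properties using (_∈?_; _⊆?_; anySubset?; p⊆p∪q; q⊆p∪q; ∣p∣≤∣x∷p∣)
open import Data.Vec using (Vec; []; _∷_; lookup; tabulate; removeAt; here; there)
open import Data.Vec.Properties
  using ( lookup∘tabulate; tabulate∘lookup; tabulate-cong; []=⇒lookup; lookup⇒[]=; removeAt-punchOut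
        ; ∷-injective; ∷-injectiveˡ; ∷-injectiveʳ)
open import Data.List
  using (List; []; _∷_; [_]; _++_; length; map; filter; concatMap; cartesianProduct; cartesianProductWith; allFin)
open import Data.List.Properties using (length-map; length-++; length-tabulate; length-removeAt′; length-filter)
open import Data.List.Relation.Unary.Any using (index; _─_) renaming (here to hereˡ; there to thereˡ)
import Data.List.Relation.Unary.All as All
open import Data.List.Relation.Unary.AllPairs using ([]; _∷_)
open import Data.List.Membership.Propositional using (lose) renaming (_∈_ to _∈ˡ_)
open import Data.List.Membership.Propositional.Properties
  using (∈-filter⁺; ∈-filter⁻; ∈-map⁺; ∈-concatMap⁺; ∈-cartesianProductWith⁺; ∈-allFin)
open import Data.List.Relation.Unary.Unique.Propositional using (Unique)
open import Data.List.Relation.Unary.Unique.Propositional.Properties using (filter⁺; cartesianProductWith⁺)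
open import Function using (_∘_; flip)
open import Function.Bundles using (_⇔_; mk⇔; Equivalence)
open import Relation.Binary.PropositionalEquality
  using (_≡_; _≢_; refl; sym; trans; cong; cong₂; subst; module ≡-Reasoning)
open import Relation.Nullary using (¬_; Dec; yes; no; contradiction)
open import Relation.Nullary.Decidable using (⌊_⌋; _×-dec_; _→-dec_)
open Equivalence using (to; from)
open +-*-Solver using (solve; _:=_; _:+_; _:*_; con)

private
  variable
    A B : Set
    m n : ℕ

∈-─ : ∀ {x y : A} {xs} (x∈xs : x ∈ˡ xs) → y ∈ˡ xs → y ≢ x → y ∈ˡ (xs ─ x∈xs)
∈-─ (hereˡ refl) (hereˡ refl) y≢x = contradiction refl y≢x
∈-─ (hereˡ _)    (thereˡ y∈)  _   = y∈
∈-─ (thereˡ _)   (hereˡ refl) _   = hereˡ refl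
∈-─ (thereˡ x∈)  (thereˡ y∈)  y≢x = thereˡ (∈-─ x∈ y∈ y≢x)

-- Stated for a relation so that no image has to be chosen for each x.
injection⇒length≤ : ∀ {xs : List A} {ys : List B} (R : A → B → Set) →
                    (∀ {x x′ y} → R x y → R x′ y → x ≡ x′) → Unique xs →
                    (∀ {x} → x ∈ˡ xs → ∃ λ y → y ∈ˡ ys × R x y) → length xs ≤ length ys
injection⇒length≤ {xs = []}     R _     _            _     = z≤n
injection⇒length≤ {xs = x ∷ xs} {ys} R R-inj (x∉xs ∷ u) cover
  with y , y∈ys , Rxy ← cover (hereˡ refl) = begin
    suc (length xs)          ≤⟨ s≤s (injection⇒length≤ R R-inj u cover′) ⟩
    suc (length (ys ─ y∈ys)) ≡⟨ length-removeAt′ ys (index y∈ys) ⟨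
    length ys                ∎
  where
  open ≤-Reasoning
  cover′ : ∀ {x′} → x′ ∈ˡ xs → ∃ λ y′ → y′ ∈ˡ (ys ─ y∈ys) × R x′ y′
  cover′ x′∈xs with y′ , y′∈ys , Rx′y′ ← cover (thereˡ x′∈xs) =
    y′ , ∈-─ y∈ys y′∈ys (λ { refl → All.lookup x∉xs x′∈xs (R-inj Rxy Rx′y′) }) , Rx′y′

Unique-⊆⇒length≤ : ∀ {xs ys : List A} → Unique xs → (∀ {x} → x ∈ˡ xs → x ∈ˡ ys) → length xs ≤ length ys
Unique-⊆⇒length≤ u xs⊆ys = injection⇒length≤ _≡_ (λ p q → trans p (sym q)) u (λ x∈ → _ , xs⊆ys x∈ , refl)

length-concatMap≤ : ∀ (f : A → List B) xs {b} → (∀ {x} → x ∈ˡ xs → length (f x) ≤ b) →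
                    length (concatMap f xs) ≤ length xs * b
length-concatMap≤ f []       _ = z≤n
length-concatMap≤ f (x ∷ xs) {b} h = begin
  length (f x ++ concatMap f xs)         ≡⟨ length-++ (f x) ⟩
  length (f x) + length (concatMap f xs) ≤⟨ +-mono-≤ (h (hereˡ refl)) (length-concatMap≤ f xs (h ∘ thereˡ)) ⟩
  b + length xs * b                      ∎
  where open ≤-Reasoning

length-cartesianProductWith : ∀ {C : Set} (f : A → B → C) xs ys →
                              length (cartesianProductWith f xs ys) ≡ length xs * length ys
length-cartesianProductWith f []       ys = refl
length-cartesianProductWith f (x ∷ xs) ys = begin
  length (map (f x) ys ++ cartesianProductWith f xs ys)
    ≡⟨ length-++ (map (f x) ys) ⟩
  length (map (f x) ys) + length (cartesianProductWith f xs ys)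
    ≡⟨ cong₂ _+_ (length-map (f x) ys) (length-cartesianProductWith f xs ys) ⟩
  length ys + length xs * length ys ∎
  where open ≡-Reasoning

concatMap-map≡cartesianProductWith : ∀ {C : Set} (f : A → B → C) xs ys →
                                     concatMap (λ x → map (f x) ys) xs ≡ cartesianProductWith f xs ys
concatMap-map≡cartesianProductWith f []       ys = refl
concatMap-map≡cartesianProductWith f (x ∷ xs) ys =
  cong (map (f x) ys ++_) (concatMap-map≡cartesianProductWith f xs ys)

allVecsOf : List A → (k : ℕ) → List (Vec A k)
allVecsOf xs zero    = [ [] ]
allVecsOf xs (suc k) = cartesianProductWith (flip _∷_) (allVecsOf xs k) xs

module _ {xs : List A} where

  allVecsOf-unique : Unique xs → ∀ k → Unique (allVecsOf xs k)
  allVecsOf-unique u zero    = All.[] ∷ []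
  allVecsOf-unique u (suc k) =
    cartesianProductWith⁺ (flip _∷_) (λ e → let x≡y , v≡w = ∷-injective e in v≡w , x≡y) (allVecsOf-unique u k) u

  ∈-allVecsOf : (∀ x → x ∈ˡ xs) → ∀ {k} (v : Vec A k) → v ∈ˡ allVecsOf xs k
  ∈-allVecsOf all []      = hereˡ refl
  ∈-allVecsOf all (x ∷ v) = ∈-cartesianProductWith⁺ (flip _∷_) (∈-allVecsOf all v) (all x)

  length-allVecsOf : ∀ k → length (allVecsOf xs k) ≡ length xs ^ k
  length-allVecsOf zero    = refl
  length-allVecsOf (suc k) = begin
    length (allVecsOf xs (suc k))       ≡⟨ length-cartesianProductWith (flip _∷_) (allVecsOf xs k) xs ⟩
    length (allVecsOf xs k) * length xs ≡⟨ cong (_* length xs) (length-allVecsOf k) ⟩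
    length xs ^ k * length xs           ≡⟨ *-comm (length xs ^ k) (length xs) ⟩
    length xs ^ suc k                   ∎
    where open ≡-Reasoning

colors : List Col
colors = none ∷ red ∷ blue ∷ []

∈-colors : ∀ c → c ∈ˡ colors
∈-colors none = hereˡ refl
∈-colors red  = thereˡ (hereˡ refl)
∈-colors blue = thereˡ (thereˡ (hereˡ refl))

allVecs≡allVecsOf : ∀ k → allVecs k ≡ allVecsOf colors k
allVecs≡allVecsOf zero    = refl
allVecs≡allVecsOf (suc k) =
  trans (concatMap-map≡cartesianProductWith (flip _∷_) (allVecs k) colors)
        (cong (λ vs → cartesianProductWith (flip _∷_) vs colors) (allVecs≡allVecsOf k))

allVecs-unique : ∀ k → Unique (allVecs k)
allVecs-unique k = subst Unique (sym (allVecs≡allVecsOf k))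
  (allVecsOf-unique (((λ ()) All.∷ (λ ()) All.∷ All.[]) ∷ ((λ ()) All.∷ All.[]) ∷ All.[] ∷ []) k)

∈-allVecs : ∀ {k} (v : Vec Col k) → v ∈ˡ allVecs k
∈-allVecs {k} v = subst (v ∈ˡ_) (sym (allVecs≡allVecsOf k)) (∈-allVecsOf ∈-colors v)

length-allVecs : ∀ k → length (allVecs k) ≡ 3 ^ k
length-allVecs k = trans (cong length (allVecs≡allVecsOf k)) (length-allVecsOf k)

allGraphs-suc : ∀ m → allGraphs (suc m) ≡ cartesianProduct (allGraphs m) (allVecs m)
allGraphs-suc m = concatMap-map≡cartesianProductWith _,_ (allGraphs m) (allVecs m)

allGraphs-unique : ∀ m → Unique (allGraphs m)
allGraphs-unique zero    = All.[] ∷ []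
allGraphs-unique (suc m) = subst Unique (sym (allGraphs-suc m))
  (cartesianProductWith⁺ _,_ (λ { refl → refl , refl }) (allGraphs-unique m) (allVecs-unique m))

∈-allGraphs : ∀ {m} (g : Graph m) → g ∈ˡ allGraphs m
∈-allGraphs {zero}  _       = hereˡ refl
∈-allGraphs {suc m} (g , v) = subst ((g , v) ∈ˡ_) (sym (allGraphs-suc m))
  (∈-cartesianProductWith⁺ _,_ (∈-allGraphs g) (∈-allVecs v))

allSubsets : ∀ n → List (Subset n)
allSubsets = allVecsOf (true ∷ false ∷ [])

∈-allSubsets : ∀ {n} (S : Subset n) → S ∈ˡ allSubsets n
∈-allSubsets = ∈-allVecsOf λ { true → hereˡ refl ; false → thereˡ (hereˡ refl) }

col-sym : ∀ {m} (g : Graph m) i j → col g i j ≡ col g j i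
col-sym {suc m} (g , v) zero    zero    = refl
col-sym {suc m} (g , v) zero    (suc j) = refl
col-sym {suc m} (g , v) (suc i) zero    = refl
col-sym {suc m} (g , v) (suc i) (suc j) = col-sym g i j

col-diag : ∀ {m} (g : Graph m) i → col g i i ≡ none
col-diag {suc m} (g , v) zero    = refl
col-diag {suc m} (g , v) (suc i) = col-diag g i

graph-ext : ∀ {m} (g h : Graph m) → (∀ i j → col g i j ≡ col h i j) → g ≡ h
graph-ext {zero}  _       _       _ = refl
graph-ext {suc m} (g , v) (h , w) e = cong₂ _,_ (graph-ext g h λ i j → e (suc i) (suc j)) v≡w
  where
  v≡w : v ≡ w
  v≡w = trans (sym (tabulate∘lookup v)) (trans (tabulate-cong (λ j → e zero (suc j))) (tabulate∘lookup w))

fromColoring : (Fin m → Fin m → Col) → Graph m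
fromColoring {zero}  c = _
fromColoring {suc m} c = fromColoring (λ i j → c (suc i) (suc j)) , tabulate (λ j → c zero (suc j))

col-fromColoring : (c : Fin m → Fin m → Col) → (∀ i j → c i j ≡ c j i) → (∀ i → c i i ≡ none) →
                    ∀ i j → col (fromColoring c) i j ≡ c i j
col-fromColoring {suc m} c sym-c diag-c zero    zero    = sym (diag-c zero)
col-fromColoring {suc m} c sym-c diag-c zero    (suc j) = lookup∘tabulate _ j
col-fromColoring {suc m} c sym-c diag-c (suc i) zero    = trans (lookup∘tabulate _ i) (sym-c zero (suc i))
col-fromColoring {suc m} c sym-c diag-c (suc i) (suc j) =
  col-fromColoring (λ i j → c (suc i) (suc j)) (λ i j → sym-c (suc i) (suc j)) (diag-c ∘ suc) i j

OBTF-pullback : ∀ (f : Fin m → Fin n) → (∀ {i j} → i Fin.< j → f i Fin.< f j) →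
                (g : Graph n) (h : Graph m) → (∀ i j → col h i j ≡ col g (f i) (f j)) →
                OBTF g → OBTF h
OBTF-pullback f f-mono g h h≡g obtf x y z (x<y , y<z , triangle) =
  obtf (f x) (f y) (f z) (f-mono x<y , f-mono y<z ,
    subst (λ (c₁ , c₂ , c₃) → Edge c₁ × Edge c₂ × Edge c₃ × Odd (blueN c₁ + blueN c₂ + blueN c₃))
          (cong₂ _,_ (h≡g x y) (cong₂ _,_ (h≡g y z) (h≡g x z))) triangle)

removeVertex : Fin (suc m) → Graph (suc m) → Graph m
removeVertex x g = fromColoring λ i j → col g (punchIn x i) (punchIn x j)

col-removeVertex : ∀ x (g : Graph (suc m)) i j → col (removeVertex x g) i j ≡ col g (punchIn x i) (punchIn x j)
col-removeVertex x g =
  col-fromColoring _ (λ i j → col-sym g (punchIn x i) (punchIn x j)) (λ i → col-diag g (punchIn x i))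

punchIn-mono-< : ∀ (x : Fin (suc m)) {i j} → i Fin.< j → punchIn x i Fin.< punchIn x j
punchIn-mono-< x {i} {j} i<j = ≰⇒> λ x[j]≤x[i] → <⇒≱ i<j (Finₚ.punchIn-cancel-≤ x j i x[j]≤x[i])

OBTF-removeVertex : ∀ x (g : Graph (suc m)) → OBTF g → OBTF (removeVertex x g)
OBTF-removeVertex x g = OBTF-pullback (punchIn x) (punchIn-mono-< x) g _ (col-removeVertex x g)

row : Fin (suc m) → Graph (suc m) → Vec Col m
row x g = tabulate λ j → col g x (punchIn x j)

data PunchInView (x : Fin (suc m)) : Fin (suc m) → Set where
  at      : PunchInView x x
  punched : ∀ k → PunchInView x (punchIn x k)

punchInView : ∀ (x : Fin (suc m)) j → PunchInView x j
punchInView x j with x Finₚ.≟ j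
... | yes refl = at
... | no x≢j   = subst (PunchInView x) (Finₚ.punchIn-punchOut x≢j) (punched (punchOut x≢j))

row-removeVertex-injective : ∀ x (g h : Graph (suc m)) →
                             row x g ≡ row x h → removeVertex x g ≡ removeVertex x h → g ≡ h
row-removeVertex-injective x g h rows≡ rests≡ = graph-ext g h cols≡
  where
  col-x≡ : ∀ j → col g x j ≡ col h x j
  col-x≡ j with punchInView x j
  ... | at        = trans (col-diag g x) (sym (col-diag h x))
  ... | punched k = begin
    col g x (punchIn x k) ≡⟨ lookup∘tabulate _ k ⟨
    lookup (row x g) k    ≡⟨ cong (λ r → lookup r k) rows≡ ⟩
    lookup (row x h) k    ≡⟨ lookup∘tabulate _ k ⟩
    col h x (punchIn x k) ∎
    where open ≡-Reasoning
  cols≡ : ∀ i j → col g i j ≡ col h i j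
  cols≡ i j with punchInView x i | punchInView x j
  ... | at        | _         = col-x≡ j
  ... | punched k | at        =
    trans (col-sym g (punchIn x k) x) (trans (col-x≡ (punchIn x k)) (col-sym h x (punchIn x k)))
  ... | punched k | punched l = begin
    col g (punchIn x k) (punchIn x l) ≡⟨ col-removeVertex x g k l ⟨
    col (removeVertex x g) k l        ≡⟨ cong (λ r → col r k l) rests≡ ⟩
    col (removeVertex x h) k l        ≡⟨ col-removeVertex x h k l ⟩
    col h (punchIn x k) (punchIn x l) ∎
    where open ≡-Reasoning

isYes≡true⇔ : ∀ {P : Set} (P? : Dec P) → ⌊ P? ⌋ ≡ true ⇔ P
isYes≡true⇔ (yes p) = mk⇔ (λ _ → p) (λ _ → refl)
isYes≡true⇔ (no ¬p) = mk⇔ (λ ()) (λ p → contradiction p ¬p)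

∈-tabulate⇔ : ∀ {P : Fin n → Set} (P? : ∀ y → Dec (P y)) y → y ∈ tabulate (λ y → ⌊ P? y ⌋) ⇔ P y
∈-tabulate⇔ P? y = mk⇔
  (λ y∈ → to (isYes≡true⇔ (P? y)) (trans (sym (lookup∘tabulate _ y)) ([]=⇒lookup y∈)))
  (λ Py → lookup⇒[]= y _ (trans (lookup∘tabulate _ y) (from (isYes≡true⇔ (P? y)) Py)))

∈Γ⇔ : ∀ (g : Graph n) Q y → y ∈ Γ g Q ⇔ (y ∉ Q × ∃ λ x → x ∈ Q × Adj g x y)
∈Γ⇔ g Q = ∈-tabulate⇔ _

∣p∪q∣≤∣p∣+∣q∣ : ∀ (p q : Subset n) → ∣ p ∪ q ∣ ≤ ∣ p ∣ + ∣ q ∣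
∣p∪q∣≤∣p∣+∣q∣ []            []            = z≤n
∣p∪q∣≤∣p∣+∣q∣ (outside ∷ p) (outside ∷ q) = ∣p∪q∣≤∣p∣+∣q∣ p q
∣p∪q∣≤∣p∣+∣q∣ (outside ∷ p) (inside  ∷ q) =
  ≤-trans (s≤s (∣p∪q∣≤∣p∣+∣q∣ p q)) (≤-reflexive (sym (+-suc ∣ p ∣ ∣ q ∣)))
∣p∪q∣≤∣p∣+∣q∣ (inside  ∷ p) (outside ∷ q) = s≤s (∣p∪q∣≤∣p∣+∣q∣ p q)
∣p∪q∣≤∣p∣+∣q∣ (inside  ∷ p) (inside  ∷ q) =
  s≤s (≤-trans (∣p∪q∣≤∣p∣+∣q∣ p q) (+-monoʳ-≤ ∣ p ∣ (n≤1+n ∣ q ∣)))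

∣p∣≡1+k⇒Nonempty : ∀ (p : Subset n) {k} → ∣ p ∣ ≡ suc k → Nonempty p
∣p∣≡1+k⇒Nonempty []            ()
∣p∣≡1+k⇒Nonempty (inside  ∷ p) _ = zero , here
∣p∣≡1+k⇒Nonempty (outside ∷ p) e with x , x∈p ← ∣p∣≡1+k⇒Nonempty p e = suc x , there x∈p

lookup-removeAt : ∀ (v : Vec A (suc n)) x j → lookup (removeAt v x) j ≡ lookup v (punchIn x j)
lookup-removeAt v x j = trans (cong (lookup (removeAt v x)) (sym (Finₚ.punchOut-punchIn x)))
                              (removeAt-punchOut v (Finₚ.punchInᵢ≢i x j ∘ sym))

∈-removeAt⁺ : ∀ (p : Subset (suc n)) x {j} → punchIn x j ∈ p → j ∈ removeAt p x
∈-removeAt⁺ p x {j} j∈p = lookup⇒[]= j _ (trans (lookup-removeAt p x j) ([]=⇒lookup j∈p))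

∈-removeAt⁻ : ∀ (p : Subset (suc n)) x {j} → j ∈ removeAt p x → punchIn x j ∈ p
∈-removeAt⁻ p x {j} j∈p = lookup⇒[]= (punchIn x j) p (trans (sym (lookup-removeAt p x j)) ([]=⇒lookup j∈p))

removeAt-mono-⊆ : ∀ {p q : Subset (suc n)} x → p ⊆ q → removeAt p x ⊆ removeAt q x
removeAt-mono-⊆ {p = p} {q} x p⊆q = ∈-removeAt⁺ q x ∘ p⊆q ∘ ∈-removeAt⁻ p x

∣x∷p∣-monoʳ-≤ : ∀ b {p : Subset m} {q : Subset n} → ∣ p ∣ ≤ ∣ q ∣ → ∣ b ∷ p ∣ ≤ ∣ b ∷ q ∣
∣x∷p∣-monoʳ-≤ inside  p≤q = s≤s p≤q
∣x∷p∣-monoʳ-≤ outside p≤q = p≤q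

∣removeAt∣≤ : ∀ (p : Subset (suc n)) x → ∣ removeAt p x ∣ ≤ ∣ p ∣
∣removeAt∣≤ (b ∷ p)     zero    = ∣p∣≤∣x∷p∣ b p
∣removeAt∣≤ (b ∷ c ∷ p) (suc x) = ∣x∷p∣-monoʳ-≤ b {removeAt (c ∷ p) x} {c ∷ p} (∣removeAt∣≤ (c ∷ p) x)

∣removeAt∣-∈ : ∀ (p : Subset (suc n)) {x} → x ∈ p → suc ∣ removeAt p x ∣ ≡ ∣ p ∣
∣removeAt∣-∈ (inside  ∷ p)     here        = refl
∣removeAt∣-∈ (inside  ∷ c ∷ p) (there x∈p) = cong suc (∣removeAt∣-∈ (c ∷ p) x∈p)
∣removeAt∣-∈ (outside ∷ c ∷ p) (there x∈p) = ∣removeAt∣-∈ (c ∷ p) x∈p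

¬Edge⇒≡none : ∀ {c} → ¬ Edge c → c ≡ none
¬Edge⇒≡none {none} _  = refl
¬Edge⇒≡none {red}  ¬e = contradiction (λ ()) ¬e
¬Edge⇒≡none {blue} ¬e = contradiction (λ ()) ¬e

SupportedOn : Subset m → Vec Col m → Set
SupportedOn R v = ∀ j → Edge (lookup v j) → j ∈ R

SupportedOn? : (R : Subset m) (v : Vec Col m) → Dec (SupportedOn R v)
SupportedOn? R v = Finₚ.all? λ j → edge? (lookup v j) →-dec (j ∈? R)

restrict : (R : Subset m) → Vec A m → Vec A ∣ R ∣
restrict []            []      = []
restrict (inside  ∷ R) (c ∷ v) = c ∷ restrict R v
restrict (outside ∷ R) (c ∷ v) = restrict R v

SupportedOn-tail : ∀ {b c} {R : Subset m} {v} → SupportedOn (b ∷ R) (c ∷ v) → SupportedOn R v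
SupportedOn-tail s j e with there j∈R ← s (suc j) e = j∈R

SupportedOn-head : ∀ {c} {R : Subset m} {v} → SupportedOn (outside ∷ R) (c ∷ v) → c ≡ none
SupportedOn-head s = ¬Edge⇒≡none λ e → contradiction (s zero e) λ ()

restrict-injective : ∀ (R : Subset m) {v w} → SupportedOn R v → SupportedOn R w →
                     restrict R v ≡ restrict R w → v ≡ w
restrict-injective []            {[]}    {[]}    _  _  _ = refl
restrict-injective (inside  ∷ R) {c ∷ v} {d ∷ w} sv sw e =
  cong₂ _∷_ (∷-injectiveˡ e)
            (restrict-injective R (SupportedOn-tail sv) (SupportedOn-tail sw) (∷-injectiveʳ e))
restrict-injective (outside ∷ R) {c ∷ v} {d ∷ w} sv sw e =
  cong₂ _∷_ (trans (SupportedOn-head sv) (sym (SupportedOn-head sw)))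
            (restrict-injective R (SupportedOn-tail sv) (SupportedOn-tail sw) e)

count-SupportedOn : ∀ (R : Subset m) → length (filter (SupportedOn? R) (allVecs m)) ≤ 3 ^ ∣ R ∣
count-SupportedOn {m} R = begin
  length (filter (SupportedOn? R) (allVecs m))
    ≤⟨ injection⇒length≤ (λ v w → SupportedOn R v × restrict R v ≡ w)
         (λ (sv , rv) (sw , rw) → restrict-injective R sv sw (trans rv (sym rw)))
         (filter⁺ (SupportedOn? R) (allVecs-unique m))
         (λ v∈ → _ , ∈-allVecs _ , proj₂ (∈-filter⁻ (SupportedOn? R) {xs = allVecs m} v∈) , refl) ⟩
  length (allVecs ∣ R ∣) ≡⟨ length-allVecs ∣ R ∣ ⟩
  3 ^ ∣ R ∣ ∎
  where open ≤-Reasoning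

-- Graphs with a confined set

Confined : ℕ → Subset n → Graph n → Set
Confined t S g = OBTF g × ∃[ Q ] (∣ Q ∣ ≡ t × Q ⊆ S × Γ g Q ⊆ S)

Confined? : ∀ t (S : Subset n) g → Dec (Confined t S g)
Confined? t S g = OBTF? g ×-dec anySubset? λ Q → (∣ Q ∣ ≟ t) ×-dec (Q ⊆? S) ×-dec (Γ g Q ⊆? S)

neighbour-∈ : ∀ {g : Graph n} {Q S x y} → x ∈ Q → Q ⊆ S → Γ g Q ⊆ S → Adj g x y → y ∈ S
neighbour-∈ {g = g} {Q} {y = y} x∈Q Q⊆S ΓQ⊆S e with y ∈? Q
... | yes y∈Q = Q⊆S y∈Q
... | no  y∉Q = ΓQ⊆S (from (∈Γ⇔ g Q y) (y∉Q , _ , x∈Q , e))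

row-SupportedOn : ∀ {g : Graph (suc m)} {Q S x} → x ∈ Q → Q ⊆ S → Γ g Q ⊆ S →
                  SupportedOn (removeAt S x) (row x g)
row-SupportedOn {S = S} {x} x∈Q Q⊆S ΓQ⊆S j e =
  ∈-removeAt⁺ S x (neighbour-∈ x∈Q Q⊆S ΓQ⊆S (subst Edge (lookup∘tabulate _ j) e))

Γ-removeVertex : ∀ x (g : Graph (suc m)) Q {j} →
                 j ∈ Γ (removeVertex x g) (removeAt Q x) → punchIn x j ∈ Γ g Q
Γ-removeVertex x g Q {j} j∈Γ with j∉ , i , i∈ , e ← to (∈Γ⇔ (removeVertex x g) (removeAt Q x) j) j∈Γ =
  from (∈Γ⇔ g Q (punchIn x j))
    (j∉ ∘ ∈-removeAt⁺ Q x , punchIn x i , ∈-removeAt⁻ Q x i∈ , subst Edge (col-removeVertex x g i j) e)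

removeVertex-Confined : ∀ {t} {g : Graph (suc m)} {Q S x} → x ∈ Q → OBTF g →
                        ∣ Q ∣ ≡ suc t → Q ⊆ S → Γ g Q ⊆ S →
                        Confined t (removeAt S x) (removeVertex x g)
removeVertex-Confined {g = g} {Q} {S} {x} x∈Q obtf ∣Q∣≡ Q⊆S ΓQ⊆S =
  OBTF-removeVertex x g obtf , removeAt Q x , suc-injective (trans (∣removeAt∣-∈ Q x∈Q) ∣Q∣≡) ,
  removeAt-mono-⊆ x Q⊆S , ∈-removeAt⁺ S x ∘ ΓQ⊆S ∘ Γ-removeVertex x g Q

module _ (t : ℕ) (S : Subset (suc m)) where

  Encodes : Graph (suc m) → Fin (suc m) × Vec Col m × Graph m → Set
  Encodes g (x , v , h) = row x g ≡ v × removeVertex x g ≡ h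

  Encodes-injective : ∀ {g g′ y} → Encodes g y → Encodes g′ y → g ≡ g′
  Encodes-injective {g} {g′} {x , _ , _} (r₁ , d₁) (r₂ , d₂) =
    row-removeVertex-injective x g g′ (trans r₁ (sym r₂)) (trans d₁ (sym d₂))

  encodings : Fin (suc m) → List (Fin (suc m) × Vec Col m × Graph m)
  encodings x = map (x ,_) (cartesianProduct (filter (SupportedOn? (removeAt S x)) (allVecs m))
                                             (filter (Confined? t (removeAt S x)) (allGraphs m)))

  Confined⇒encoded : ∀ {g} → Confined (suc t) S g →
                     ∃ λ y → y ∈ˡ concatMap encodings (allFin (suc m)) × Encodes g y
  Confined⇒encoded (obtf , Q , ∣Q∣≡ , Q⊆S , ΓQ⊆S) with x , x∈Q ← ∣p∣≡1+k⇒Nonempty Q ∣Q∣≡ =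
    _ , ∈-concatMap⁺ encodings (lose (∈-allFin x) (∈-map⁺ (x ,_) (∈-cartesianProductWith⁺ _,_
          (∈-filter⁺ (SupportedOn? (removeAt S x)) (∈-allVecs _) (row-SupportedOn x∈Q Q⊆S ΓQ⊆S))
          (∈-filter⁺ (Confined? t (removeAt S x)) (∈-allGraphs _)
             (removeVertex-Confined x∈Q obtf ∣Q∣≡ Q⊆S ΓQ⊆S)))))
    , refl , refl

  length-encodings : (∀ (R : Subset m) →
                        length (filter (Confined? t R) (allGraphs m)) ≤ m ^ t * 3 ^ (t * ∣ R ∣) * F (m ∸ t)) →
                     ∀ x → length (encodings x) ≤ 3 ^ ∣ S ∣ * (suc m ^ t * 3 ^ (t * ∣ S ∣) * F (m ∸ t))
  length-encodings IH x = begin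
    length (encodings x)
      ≡⟨ trans (length-map (x ,_) (cartesianProduct vs hs)) (length-cartesianProductWith _,_ vs hs) ⟩
    length vs * length hs
      ≤⟨ *-mono-≤ (≤-trans (count-SupportedOn S-x) (^-monoʳ-≤ 3 r≤s)) (≤-trans (IH S-x) enlarge) ⟩
    3 ^ ∣ S ∣ * (suc m ^ t * 3 ^ (t * ∣ S ∣) * F (m ∸ t)) ∎
    where
    open ≤-Reasoning
    S-x = removeAt S x
    vs = filter (SupportedOn? S-x) (allVecs m)
    hs = filter (Confined? t S-x) (allGraphs m)
    r≤s = ∣removeAt∣≤ S x
    enlarge : m ^ t * 3 ^ (t * ∣ S-x ∣) * F (m ∸ t) ≤ suc m ^ t * 3 ^ (t * ∣ S ∣) * F (m ∸ t)
    enlarge = *-monoˡ-≤ (F (m ∸ t)) (*-mono-≤ (^-monoˡ-≤ t (n≤1+n m)) (^-monoʳ-≤ 3 (*-monoʳ-≤ t r≤s)))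

count-Confined : ∀ t (S : Subset n) →
                 length (filter (Confined? t S) (allGraphs n)) ≤ n ^ t * 3 ^ (t * ∣ S ∣) * F (n ∸ t)
count-Confined {n} zero S = begin
  length (filter (Confined? 0 S) (allGraphs n))
    ≤⟨ Unique-⊆⇒length≤ (filter⁺ (Confined? 0 S) (allGraphs-unique n)) Confined⇒OBTF ⟩
  F n     ≡⟨ *-identityˡ (F n) ⟨
  1 * F n ∎
  where
  open ≤-Reasoning
  Confined⇒OBTF : ∀ {g} → g ∈ˡ filter (Confined? 0 S) (allGraphs n) → g ∈ˡ filter OBTF? (allGraphs n)
  Confined⇒OBTF g∈ with g∈all , obtf , _ ← ∈-filter⁻ (Confined? 0 S) {xs = allGraphs n} g∈ =
    ∈-filter⁺ OBTF? g∈all obtf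
count-Confined {zero} (suc t) [] =
  Unique-⊆⇒length≤ {ys = []} (filter⁺ (Confined? (suc t) []) (allGraphs-unique 0)) λ g∈ →
    Confined-∅-elim (proj₂ (∈-filter⁻ (Confined? (suc t) []) {xs = allGraphs 0} g∈))
  where
  Confined-∅-elim : ∀ {g} {B : Set} → Confined (suc t) [] g → B
  Confined-∅-elim (_ , [] , () , _)
count-Confined {suc m} (suc t) S = begin
  length (filter (Confined? (suc t) S) (allGraphs (suc m)))
    ≤⟨ injection⇒length≤ (Encodes t S) (λ {_} {_} {y} → Encodes-injective t S {y = y})
         (filter⁺ (Confined? (suc t) S) (allGraphs-unique (suc m)))
         (Confined⇒encoded t S ∘ proj₂ ∘ ∈-filter⁻ (Confined? (suc t) S) {xs = allGraphs (suc m)}) ⟩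
  length (concatMap (encodings t S) (allFin (suc m)))
    ≤⟨ length-concatMap≤ (encodings t S) (allFin (suc m)) (λ {x} _ → length-encodings t S (count-Confined t) x) ⟩
  length (allFin (suc m)) * (3 ^ s * (suc m ^ t * 3 ^ (t * s) * F (m ∸ t)))
    ≡⟨ cong (_* (3 ^ s * (suc m ^ t * 3 ^ (t * s) * F (m ∸ t)))) (length-tabulate {n = suc m} (λ x → x)) ⟩
  suc m * (3 ^ s * (suc m ^ t * 3 ^ (t * s) * F (m ∸ t)))
    ≡⟨ solve 5 (λ a b c d e → a :* (b :* (c :* d :* e)) := a :* c :* (b :* d) :* e) refl
               (suc m) (3 ^ s) (suc m ^ t) (3 ^ (t * s)) (F (m ∸ t)) ⟩
  suc m ^ suc t * (3 ^ s * 3 ^ (t * s)) * F (m ∸ t)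
    ≡⟨ cong (λ k → suc m ^ suc t * k * F (m ∸ t)) (^-distribˡ-+-* 3 s (t * s)) ⟨
  suc m ^ suc t * 3 ^ (suc t * s) * F (m ∸ t) ∎
  where
  open ≤-Reasoning
  s = ∣ S ∣

d*m≤n⇒m≤n/d : ∀ {m n} d .{{_ : NonZero d}} → d * m ≤ n → m ≤ n / d
d*m≤n⇒m≤n/d {m} {n} d dm≤n = begin
  m         ≡⟨ m*n/n≡m m d ⟨
  m * d / d ≤⟨ /-monoˡ-≤ d (≤-trans (≤-reflexive (*-comm m d)) dm≤n) ⟩
  n / d     ∎
  where open ≤-Reasoning

X0cond⇒Confined : ∀ {t} {g : Graph n} → OBTF g → X0cond t g →
                  ∃ λ S → 5 * ∣ S ∣ ≤ 5 * t + 3 * n × Confined t S g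
X0cond⇒Confined {n} {t} {g} obtf (Q , ∣Q∣≡t , 5∣ΓQ∣<3n) =
  Q ∪ Γ g Q , 5∣S∣≤ , obtf , Q , ∣Q∣≡t , p⊆p∪q (Γ g Q) , q⊆p∪q Q (Γ g Q)
  where
  open ≤-Reasoning
  5∣S∣≤ : 5 * ∣ Q ∪ Γ g Q ∣ ≤ 5 * t + 3 * n
  5∣S∣≤ = begin
    5 * ∣ Q ∪ Γ g Q ∣         ≤⟨ *-monoʳ-≤ 5 (∣p∪q∣≤∣p∣+∣q∣ Q (Γ g Q)) ⟩
    5 * (∣ Q ∣ + ∣ Γ g Q ∣)   ≡⟨ *-distribˡ-+ 5 ∣ Q ∣ ∣ Γ g Q ∣ ⟩
    5 * ∣ Q ∣ + 5 * ∣ Γ g Q ∣ ≤⟨ +-mono-≤ (≤-reflexive (cong (5 *_) ∣Q∣≡t)) (<⇒≤ 5∣ΓQ∣<3n) ⟩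
    5 * t + 3 * n             ∎

X0count≤ : ∀ n t → X0count n t ≤ 2 ^ n * (n ^ t * 3 ^ (t * ((5 * t + 3 * n) / 5)) * F (n ∸ t))
X0count≤ n t = begin
  X0count n t
    ≤⟨ injection⇒length≤ (λ g y → g ≡ proj₂ y) (λ p q → trans p (sym q))
         (filter⁺ (λ g → OBTF? g ×-dec X0cond? t g) (allGraphs-unique n)) cover ⟩
  length (concatMap witnessed admissible)
    ≤⟨ length-concatMap≤ witnessed admissible length-witnessed ⟩
  length admissible * bound
    ≤⟨ *-monoˡ-≤ bound (≤-trans (length-filter admissible? (allSubsets n)) (≤-reflexive (length-allVecsOf n))) ⟩
  2 ^ n * bound ∎
  where
  open ≤-Reasoning
  bound = n ^ t * 3 ^ (t * ((5 * t + 3 * n) / 5)) * F (n ∸ t)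

  admissible? : ∀ (S : Subset n) → Dec (5 * ∣ S ∣ ≤ 5 * t + 3 * n)
  admissible? S = 5 * ∣ S ∣ ≤? 5 * t + 3 * n

  admissible : List (Subset n)
  admissible = filter admissible? (allSubsets n)

  witnessed : Subset n → List (Subset n × Graph n)
  witnessed S = map (S ,_) (filter (Confined? t S) (allGraphs n))

  length-witnessed : ∀ {S} → S ∈ˡ admissible → length (witnessed S) ≤ bound
  length-witnessed {S} S∈ = begin
    length (witnessed S)                          ≡⟨ length-map (S ,_) (filter (Confined? t S) (allGraphs n)) ⟩
    length (filter (Confined? t S) (allGraphs n)) ≤⟨ count-Confined t S ⟩
    n ^ t * 3 ^ (t * ∣ S ∣) * F (n ∸ t)
      ≤⟨ *-monoˡ-≤ (F (n ∸ t)) (*-monoʳ-≤ (n ^ t) (^-monoʳ-≤ 3 (*-monoʳ-≤ t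
           (d*m≤n⇒m≤n/d 5 (proj₂ (∈-filter⁻ admissible? {xs = allSubsets n} S∈)))))) ⟩
    bound ∎

  cover : ∀ {g} → g ∈ˡ filter (λ g → OBTF? g ×-dec X0cond? t g) (allGraphs n) →
          ∃ λ y → y ∈ˡ concatMap witnessed admissible × g ≡ proj₂ y
  cover {g} g∈ with g∈all , obtf , x0 ← ∈-filter⁻ (λ g → OBTF? g ×-dec X0cond? t g) {xs = allGraphs n} g∈
                  with S , 5∣S∣≤ , confined ← X0cond⇒Confined obtf x0 =
    (S , g) , ∈-concatMap⁺ witnessed (lose (∈-filter⁺ admissible? (∈-allSubsets S) 5∣S∣≤)
                                            (∈-map⁺ (S ,_) (∈-filter⁺ (Confined? t S) g∈all confined))) , refl

F-positive : ∀ m → 1 ≤ F m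
F-positive m =
  Unique-⊆⇒length≤ (All.[] ∷ []) λ { (hereˡ refl) → ∈-filter⁺ OBTF? (∈-allGraphs empty) empty-OBTF }
  where
  empty : Graph m
  empty = fromColoring λ _ _ → none
  empty-OBTF : OBTF empty
  empty-OBTF x y z (_ , _ , x~y , _) = x~y (col-fromColoring _ (λ _ _ → refl) (λ _ → refl) x y)

-- Asymptotics

Eventually : (ℕ → Set) → Set
Eventually P = ∃[ N ] (∀ n → N ≤ n → P n)

eventually-map : ∀ {P Q : ℕ → Set} → (∀ {n} → P n → Q n) → Eventually P → Eventually Q
eventually-map f (N , p) = N , λ n n≥N → f (p n n≥N)

eventually-∧ : ∀ {P Q : ℕ → Set} → Eventually P → Eventually Q → Eventually (λ n → P n × Q n)
eventually-∧ (M , p) (N , q) =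
  M ⊔ N , λ n n≥ → p n (≤-trans (m≤m⊔n M N) n≥) , q n (≤-trans (m≤n⊔m M N) n≥)

eventually-∘ : ∀ {P : ℕ → Set} {t : ℕ → ℕ} → (∀ M → Eventually (λ n → M ≤ t n)) →
               Eventually P → Eventually (λ n → P (t n))
eventually-∘ t→∞ (M , p) = eventually-map (p _) (t→∞ M)

eventually-induction : ∀ {P : ℕ → Set} N → P N → (∀ n → P n → P (suc n)) → Eventually P
eventually-induction {P} N pN step = N , λ n n≥N → go (≤⇒≤′ n≥N)
  where
  go : ∀ {n} → N ≤′ n → P n
  go ≤′-refl        = pN
  go (≤′-step N≤′n) = step _ (go N≤′n)

n<2^n : ∀ n → n < 2 ^ n
n<2^n zero    = s≤s z≤n
n<2^n (suc n) = begin
  2 + n         ≤⟨ +-mono-≤ (m^n>0 2 n) (n<2^n n) ⟩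
  2 ^ n + 2 ^ n ≡⟨ cong (2 ^ n +_) (+-identityʳ (2 ^ n)) ⟨
  2 ^ suc n     ∎
  where open ≤-Reasoning

linear≤2^ : ∀ a → Eventually (λ J → a * suc J ≤ 2 ^ J)
linear≤2^ a = eventually-induction (suc (a + a)) base step
  where
  base : a * suc (suc (a + a)) ≤ 2 ^ suc (a + a)
  base = begin
    a * suc (suc (a + a)) ≡⟨ solve 1 (λ a → a :* (con 2 :+ (a :+ a)) := con 2 :* (a :* (con 1 :+ a))) refl a ⟩
    2 * (a * suc a)       ≤⟨ *-monoʳ-≤ 2 (*-mono-≤ (<⇒≤ (n<2^n a)) (n<2^n a)) ⟩
    2 * (2 ^ a * 2 ^ a)   ≡⟨ cong (2 *_) (^-distribˡ-+-* 2 a a) ⟨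
    2 ^ suc (a + a)       ∎
    where open ≤-Reasoning
  step : ∀ J → a * suc J ≤ 2 ^ J → a * suc (suc J) ≤ 2 ^ suc J
  step J h = begin
    a * suc (suc J)         ≡⟨ *-suc a (suc J) ⟩
    a + a * suc J           ≤⟨ +-monoˡ-≤ (a * suc J) (m≤m*n a (suc J)) ⟩
    a * suc J + a * suc J   ≤⟨ +-mono-≤ h h ⟩
    2 ^ J + 2 ^ J           ≡⟨ cong (2 ^ J +_) (+-identityʳ (2 ^ J)) ⟨
    2 ^ suc J               ∎
    where open ≤-Reasoning

m<[1+m/n]*n : ∀ m n .{{_ : NonZero n}} → m < suc (m / n) * n
m<[1+m/n]*n m n = begin-strict
  m                 ≡⟨ m≡m%n+[m/n]*n m n ⟩
  m % n + m / n * n <⟨ +-monoˡ-< (m / n * n) (m%n<n m n) ⟩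
  n + m / n * n     ∎
  where open ≤-Reasoning

linear≤2^[/] : ∀ a d .{{_ : NonZero d}} → Eventually (λ x → a * x ≤ 2 ^ (x / d))
linear≤2^[/] a d with J₀ , h ← linear≤2^ (a * d) = d * J₀ , λ x x≥ → begin
  a * x                 ≤⟨ *-monoʳ-≤ a (<⇒≤ (m<[1+m/n]*n x d)) ⟩
  a * (suc (x / d) * d) ≡⟨ solve 3 (λ a d j → a :* (j :* d) := a :* d :* j) refl a d (suc (x / d)) ⟩
  a * d * suc (x / d)   ≤⟨ h (x / d) (d*m≤n⇒m≤n/d d x≥) ⟩
  2 ^ (x / d)           ∎
  where open ≤-Reasoning

2^t≤n^C⇒at≤n : ∀ {a t n} C .{{_ : NonZero C}} → a * t ≤ 2 ^ (t / C) → 2 ^ t ≤ n ^ C → a * t ≤ n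
2^t≤n^C⇒at≤n {a} {t} {n} C at≤2^[t/C] 2^t≤n^C = ≮⇒≥ λ n<at → <-irrefl refl (begin-strict
  2 ^ t             ≤⟨ 2^t≤n^C ⟩
  n ^ C             <⟨ ^-monoˡ-< C n<at ⟩
  (a * t) ^ C       ≤⟨ ^-monoˡ-≤ C at≤2^[t/C] ⟩
  (2 ^ (t / C)) ^ C ≡⟨ ^-*-assoc 2 (t / C) C ⟩
  2 ^ (t / C * C)   ≤⟨ ^-monoʳ-≤ 2 (m/n*n≤m t C) ⟩
  2 ^ t             ∎)
  where open ≤-Reasoning

^-distribʳ-* : ∀ a b k → (a * b) ^ k ≡ a ^ k * b ^ k
^-distribʳ-* a b zero    = refl
^-distribʳ-* a b (suc k) = begin
  a * b * (a * b) ^ k     ≡⟨ cong (a * b *_) (^-distribʳ-* a b k) ⟩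
  a * b * (a ^ k * b ^ k) ≡⟨ solve 4 (λ a b x y → a :* b :* (x :* y) := a :* x :* (b :* y)) refl a b (a ^ k) (b ^ k) ⟩
  a ^ suc k * b ^ suc k   ∎
  where open ≡-Reasoning

-- Each of the three summands on the left is at most a quarter of 5tn.
exponent-gap : ∀ {n t q L} → 1 ≤ q → 4 * q ≤ t → 4 * q * L ≤ n → 8 * q * t ≤ n →
               n * (5 * q) + L * t * (5 * q) + 2 * (5 * q * t * t) < 5 * t * n
exponent-gap {n} {t} {q} {L} q≥1 4q≤t 4qL≤n 8qt≤n = begin-strict
  n * (5 * q) + L * t * (5 * q) + 2 * (5 * q * t * t)
    ≡⟨ solve 4 (λ n t q L → n :* (con 5 :* q) :+ L :* t :* (con 5 :* q) :+ con 2 :* (con 5 :* q :* t :* t)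
                         := con 5 :* (q :* n :+ q :* t :* L :+ con 2 :* q :* t :* t)) refl n t q L ⟩
  5 * x       <⟨ *-monoʳ-< 5 x<tn ⟩
  5 * (t * n) ≡⟨ *-assoc 5 t n ⟨
  5 * t * n   ∎
  where
  open ≤-Reasoning
  x = q * n + q * t * L + 2 * q * t * t
  t≥1 : 1 ≤ t
  t≥1 = ≤-trans q≥1 (≤-trans (m≤n*m q 4) 4q≤t)
  tn≥1 : 1 ≤ t * n
  tn≥1 = *-mono-≤ t≥1 (≤-trans (*-mono-≤ (*-mono-≤ {1} {8} (s≤s z≤n) q≥1) t≥1) 8qt≤n)
  4x≤3tn : 4 * x ≤ 3 * (t * n)
  4x≤3tn = begin
    4 * x
      ≡⟨ solve 4 (λ n t q L → con 4 :* (q :* n :+ q :* t :* L :+ con 2 :* q :* t :* t)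
                           := con 4 :* q :* n :+ t :* (con 4 :* q :* L) :+ con 8 :* q :* t :* t) refl n t q L ⟩
    4 * q * n + t * (4 * q * L) + 8 * q * t * t
      ≤⟨ +-mono-≤ (+-mono-≤ (*-monoˡ-≤ n 4q≤t) (*-monoʳ-≤ t 4qL≤n)) (*-monoˡ-≤ t 8qt≤n) ⟩
    t * n + t * n + n * t
      ≡⟨ solve 2 (λ n t → t :* n :+ t :* n :+ n :* t := con 3 :* (t :* n)) refl n t ⟩
    3 * (t * n) ∎
  x<tn : x < t * n
  x<tn = *-cancelˡ-< 4 x (t * n) (≤-<-trans 4x≤3tn (m<n+m (3 * (t * n)) tn≥1))

3^[tK]^c≤ : ∀ {n t q K} → K * 5 ≤ 5 * t + 3 * n →
            (3 ^ (t * K)) ^ (5 * q) ≤ 3 ^ (3 * q * t * n) * 2 ^ (2 * (5 * q * t * t))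
3^[tK]^c≤ {n} {t} {q} {K} K*5≤ = begin
  (3 ^ (t * K)) ^ (5 * q) ≡⟨ ^-*-assoc 3 (t * K) (5 * q) ⟩
  3 ^ (t * K * (5 * q))   ≤⟨ ^-monoʳ-≤ 3 tKc≤P+Z ⟩
  3 ^ (P + Z)             ≡⟨ ^-distribˡ-+-* 3 P Z ⟩
  3 ^ P * 3 ^ Z           ≤⟨ *-monoʳ-≤ (3 ^ P) (^-monoˡ-≤ Z {3} {4} (s≤s (s≤s (s≤s z≤n)))) ⟩
  3 ^ P * 4 ^ Z           ≡⟨ cong (3 ^ P *_) (^-*-assoc 2 2 Z) ⟩
  3 ^ P * 2 ^ (2 * Z)     ∎
  where
  open ≤-Reasoning
  P = 3 * q * t * n
  Z = 5 * q * t * t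
  tKc≤P+Z : t * K * (5 * q) ≤ P + Z
  tKc≤P+Z = begin
    t * K * (5 * q)         ≡⟨ solve 3 (λ t K q → t :* K :* (con 5 :* q) := q :* t :* (K :* con 5)) refl t K q ⟩
    q * t * (K * 5)         ≤⟨ *-monoʳ-≤ (q * t) K*5≤ ⟩
    q * t * (5 * t + 3 * n) ≡⟨ solve 3 (λ t q n → q :* t :* (con 5 :* t :+ con 3 :* n)
                                              := con 3 :* q :* t :* n :+ con 5 :* q :* t :* t) refl t q n ⟩
    P + Z                   ∎

power-bound : ∀ {n t q K L X F′} → 1 ≤ q → 1 ≤ F′ → K * 5 ≤ 5 * t + 3 * n → n ≤ 2 ^ L →
              4 * q ≤ t → 4 * q * L ≤ n → 8 * q * t ≤ n →
              X ≤ 2 ^ n * (n ^ t * 3 ^ (t * K) * F′) →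
              X ^ (5 * q) < 3 ^ (3 * q * t * n) * 2 ^ (5 * t * n) * F′ ^ (5 * q)
power-bound {n} {t} {q} {K} {L} {X} {F′} q≥1 F′≥1 K*5≤ n≤2^L 4q≤t 4qL≤n 8qt≤n X≤ = begin-strict
  X ^ c
    ≤⟨ ^-monoˡ-≤ c X≤ ⟩
  (2 ^ n * (n ^ t * 3 ^ (t * K) * F′)) ^ c
    ≡⟨ trans (^-distribʳ-* (2 ^ n) _ c) (cong ((2 ^ n) ^ c *_) (trans (^-distribʳ-* (n ^ t * 3 ^ (t * K)) F′ c)
         (cong (_* F′ ^ c) (^-distribʳ-* (n ^ t) (3 ^ (t * K)) c)))) ⟩
  (2 ^ n) ^ c * ((n ^ t) ^ c * (3 ^ (t * K)) ^ c * F′ ^ c)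
    ≤⟨ *-mono-≤ (≤-reflexive (^-*-assoc 2 n c))
                (*-monoˡ-≤ (F′ ^ c) (*-mono-≤ n^t^c≤ (3^[tK]^c≤ {n} {t} {q} K*5≤))) ⟩
  2 ^ (n * c) * (2 ^ (L * t * c) * (3 ^ P * 2 ^ (2 * Z)) * F′ ^ c)
    ≡⟨ solve 5 (λ a b d e f → a :* (b :* (d :* e) :* f) := d :* (a :* b :* e) :* f) refl
         (2 ^ (n * c)) (2 ^ (L * t * c)) (3 ^ P) (2 ^ (2 * Z)) (F′ ^ c) ⟩
  3 ^ P * (2 ^ (n * c) * 2 ^ (L * t * c) * 2 ^ (2 * Z)) * F′ ^ c
    ≡⟨ cong (λ k → 3 ^ P * k * F′ ^ c)
         (trans (^-distribˡ-+-* 2 (n * c + L * t * c) (2 * Z))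
                (cong (_* 2 ^ (2 * Z)) (^-distribˡ-+-* 2 (n * c) (L * t * c)))) ⟨
  3 ^ P * 2 ^ (n * c + L * t * c + 2 * Z) * F′ ^ c
    <⟨ *-monoˡ-< (F′ ^ c) {{m^n≢0 F′ c {{>-nonZero F′≥1}}}}
         (*-monoʳ-< (3 ^ P) {{m^n≢0 3 P}}
           (^-monoʳ-< 2 (s≤s (s≤s z≤n)) (exponent-gap q≥1 4q≤t 4qL≤n 8qt≤n))) ⟩
  3 ^ P * 2 ^ (5 * t * n) * F′ ^ c ∎
  where
  open ≤-Reasoning
  c = 5 * q
  P = 3 * q * t * n
  Z = 5 * q * t * t
  n^t^c≤ : (n ^ t) ^ c ≤ 2 ^ (L * t * c)
  n^t^c≤ = ≤-trans (^-monoˡ-≤ c (^-monoˡ-≤ t n≤2^L))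
             (≤-reflexive (trans (cong (_^ c) (^-*-assoc 2 L t)) (^-*-assoc 2 (L * t) c)))

lemma1 : (C : ℕ) → 1 ≤ C → (t : ℕ → ℕ)
         → (∀ M → ∃[ N ] (∀ n → N ≤ n → M ≤ t n))
         → (∃[ N ] (∀ n → N ≤ n → 2 ^ t n ≤ n ^ C))
         → (q : ℕ) → 1 ≤ q
         → ∃[ N ] (∀ n → N ≤ n →
              X0count n (t n) ^ (5 * q)
                < 3 ^ (3 * q * t n * n) * 2 ^ (5 * t n * n) * F (n ∸ t n) ^ (5 * q))
lemma1 C C≥1 t t→∞ 2^t≤n^C q q≥1 =
  eventually-map conclude (eventually-∧ (t→∞ (4 * q)) (eventually-∧ 8qt≤n (linear≤2^[/] 1 (4 * q))))
  where
  instance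
    C≢0 : NonZero C
    C≢0 = >-nonZero C≥1
    4q≢0 : NonZero (4 * q)
    4q≢0 = m*n≢0 4 q {{_}} {{>-nonZero q≥1}}

  8qt≤n : Eventually (λ n → 8 * q * t n ≤ n)
  8qt≤n = eventually-map (λ (8qt≤2^[t/C] , 2^t≤) → 2^t≤n^C⇒at≤n {8 * q} C 8qt≤2^[t/C] 2^t≤)
            (eventually-∧ (eventually-∘ t→∞ (linear≤2^[/] (8 * q) C)) 2^t≤n^C)

  conclude : ∀ {n} → 4 * q ≤ t n × 8 * q * t n ≤ n × 1 * n ≤ 2 ^ (n / (4 * q)) →
             X0count n (t n) ^ (5 * q) < 3 ^ (3 * q * t n * n) * 2 ^ (5 * t n * n) * F (n ∸ t n) ^ (5 * q)
  conclude {n} (4q≤t , 8qt≤n , n≤2^L) =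
    power-bound q≥1 (F-positive (n ∸ t n)) (m/n*n≤m (5 * t n + 3 * n) 5)
      (subst (_≤ 2 ^ (n / (4 * q))) (*-identityˡ n) n≤2^L) 4q≤t
      (≤-trans (≤-reflexive (*-comm (4 * q) (n / (4 * q)))) (m/n*n≤m n (4 * q))) 8qt≤n
      (X0count≤ n (t n))
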